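{- Let $m\geqslant5$ be odd and let $H$, $x$, $y$, $z$ be as in the context. Then $\langle x,y,z\rangle$ is transitive on $H^*=H\setminus\{1\}$.
   Context: Permutations act on the right, written exponentially, and a product $\sigma\rho$ means first $\sigma$ then $\rho$. Let $m$ be odd, $m\geqslant5$, and $H=\langle a,b\mid a^4=b^2=(ab)^2=1\rangle\times\langle c_1\rangle\times\cdots\times\langle c_{m-3}\rangle$, where $c_1,\dots,c_{m-3}$ are involutions. Put $c_{ -1}=c_0=1$. Let $K=\langle a^2,b,c_1,\dots,c_{m-3}\rangle$ and $h=a\prod_{i=0}^{(m-5)/2}c_{2i+1}$. Let $x\in\mathrm{Aut}(H)$ be defined by $a^x=a^{ -1}$, $b^x=ab$, $c_{2i+1}^x=c_{2i+1}$, $c_{2i+2}^x=a^2c_{2i+1}c_{2i+2}$ for $0\leqslant i\leqslant(m-5)/2$. Let $\tau\in\mathrm{Aut}(K)$ be defined by $(a^2)^\tau=b$, $b^\tau=a^2$, $c_{2i+1}^\tau=c_{2i-1}c_{2i}c_{2i+2}$, $c_{2i+2}^\tau=c_{2i-1}c_{2i}c_{2i+1}$ for $0\leqslant i\leqslant(m-5)/2$. Let $R$ be the right regular representation of $H$ ($R(g):u\mapsto ug$). Let $y$ be the permutation of $H$ with $k^y=k^\tau$ and $(hk)^y=hk^\tau$ for all $k\in K$, and $z=R(h)\,y\,R(h^{ -1})$. -}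

module Defs where

open import Data.Nat as ℕ using (ℕ; zero; suc; _∸_; _<?_; ⌊_/2⌋; _%_)
open import Data.Integer as ℤ using (ℤ; +_; -[1+_])
open import Data.Fin as Fin using (Fin; toℕ; fromℕ<)
open import Data.Fin.Properties using () renaming (_≟_ to _≟ᶠ_)
open import Data.Bool using (Bool; true; false; if_then_else_; _xor_; not)
open import Data.Vec as Vec using (Vec; lookup; tabulate; replicate; zipWith)
open import Data.Product using (_×_; _,_; ∃; Σ)
open import Data.Sum using (_⊎_)
open import Relation.Nullary.Decidable using (isYes; does; yes; no)
open import Relation.Binary.PropositionalEquality using (_≡_)
open import Relation.Binary.Construct.Closure.ReflexiveTransitive using (Star)
open import Data.Nat.DivMod using (m%n<n)

Z4 : Set
Z4 = Fin 4

_+₄_ : Z4 → Z4 → Z4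
i +₄ j = fromℕ< (m%n<n (toℕ i ℕ.+ toℕ j) 4)

-₄_ : Z4 → Z4
-₄ i = fromℕ< (m%n<n (4 ∸ toℕ i) 4)

-- The group H = D8 × C2^(m-3), D8 = ⟨a,b | a^4=b^2=(ab)^2=1⟩.
-- An element (i , j , v) stands for  a^i b^j c_1^{v_1} ⋯ c_{m-3}^{v_{m-3}}
-- (v_k = true means c_{k+1} occurs, 0-based index k).

H : ℕ → Set
H m = Z4 × Bool × Vec Bool (m ∸ 3)

module _ {m : ℕ} where

  one : H m
  one = Fin.zero , false , replicate _ false

  -- (a^i b^j c^v)(a^k b^l c^w) = a^(i ± k) b^(j+l) c^(v+w), since b a^k = a^(-k) b
  _·_ : H m → H m → H m
  (i , j , v) · (k , l , w) =
    (i +₄ (if j then -₄ k else k)) , (j xor l) , zipWith _xor_ v w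

  infixl 7 _·_

  inv : H m → H m
  inv (i , true  , v) = i , true , v
  inv (i , false , v) = -₄ i , false , v

  pow : H m → ℕ → H m
  pow g zero    = one
  pow g (suc n) = g · pow g n

  prodOver : ∀ {n} → (Fin n → H m) → H m
  prodOver {zero}  f = one
  prodOver {suc n} f = f Fin.zero · prodOver (λ k → f (Fin.suc k))

  a b a² : H m
  a  = Fin.suc Fin.zero , false , replicate _ false
  b  = Fin.zero , true , replicate _ false
  a² = pow a 2

  -- generator c_(k+1), for 0-based index k
  cgen : Fin (m ∸ 3) → H m
  cgen k = Fin.zero , false , tabulate (λ j → isYes (j ≟ᶠ k))

  -- c_k for an integer (1-based) index k; c_k = 1 for k ≤ 0
  -- (convention c_{-1} = c_0 = 1). Indices > m-3 never occur.
  c : ℤ → H m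
  c -[1+ _ ]      = one
  c (+ zero)      = one
  c (+ suc k) with k <? (m ∸ 3)
  ... | yes k< = cgen (fromℕ< k<)
  ... | no  _  = one

  cprod : (Fin (m ∸ 3) → H m) → Vec Bool (m ∸ 3) → H m
  cprod img v = prodOver (λ k → if lookup v k then img k else one)

  -- 0-based index k = 2i   <-> c_{2i+1};   k = 2i+1 <-> c_{2i+2}
  half : Fin (m ∸ 3) → ℕ
  half k = ⌊ toℕ k /2⌋

  isOddIdx : Fin (m ∸ 3) → Bool
  isOddIdx k = does (toℕ k % 2 ℕ.≟ 1)

  -- x ∈ Aut(H): a ↦ a⁻¹, b ↦ ab, c_{2i+1} ↦ c_{2i+1},
  -- c_{2i+2} ↦ a² c_{2i+1} c_{2i+2}; extended homomorphically along the
  -- normal form a^i b^j c^v.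

  xc : Fin (m ∸ 3) → H m
  xc k = if isOddIdx k
         then a² · c (+ (2 ℕ.* half k ℕ.+ 1)) · c (+ (2 ℕ.* half k ℕ.+ 2))
         else c (+ (2 ℕ.* half k ℕ.+ 1))

  x : H m → H m
  x (i , j , v) = pow (inv a) (toℕ i) · pow (a · b) (if j then 1 else 0) · cprod xc v

  -- K = ⟨a², b, c_1, …, c_{m-3}⟩ = { a^i b^j c^v : i ∈ {0,2} }.
  inK : H m → Bool
  inK (i , _ , _) = does (toℕ i % 2 ℕ.≟ 0)

  -- τ ∈ Aut(K): a² ↦ b, b ↦ a², c_{2i+1} ↦ c_{2i-1} c_{2i} c_{2i+2},
  -- c_{2i+2} ↦ c_{2i-1} c_{2i} c_{2i+1}; extended homomorphically along
  -- the normal form (a²)^e b^j c^v of elements of K.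
  τc : Fin (m ∸ 3) → H m
  τc k = if isOddIdx k
         then c (+ (2 ℕ.* half k) ℤ.- + 1) · c (+ (2 ℕ.* half k)) · c (+ (2 ℕ.* half k ℕ.+ 1))
         else c (+ (2 ℕ.* half k) ℤ.- + 1) · c (+ (2 ℕ.* half k)) · c (+ (2 ℕ.* half k ℕ.+ 2))

  τ : H m → H m
  τ (i , j , v) = pow b ⌊ toℕ i /2⌋ · pow a² (if j then 1 else 0) · cprod τc v

  h : H m
  h = a · prodOver {suc ⌊ m ∸ 5 /2⌋} (λ i → c (+ (2 ℕ.* toℕ i ℕ.+ 1)))

  -- y : k ↦ k^τ, hk ↦ h k^τ  (k ∈ K); H = K ∪ hK.
  y : H m → H m
  y g = if inK g then τ g else h · τ (inv h · g)

  -- z = R(h) y R(h⁻¹), permutations acting on the right, composed left to right: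
  -- u^z = ((u h)^y) h⁻¹
  z : H m → H m
  z u = y (u · h) · inv h

  data Gen : Set where
    gx gy gz : Gen

  act : Gen → H m → H m
  act gx = x
  act gy = y
  act gz = z

  Step : H m → H m → Set
  Step u v = ∃ λ (g : Gen) → (v ≡ act g u) ⊎ (u ≡ act g v)

  SameOrbit : H m → H m → Set
  SameOrbit = Star Step

-- Write elements of H as a^i b^j c^v with v ∈ F₂^{m-3}, read as pairs (c_{2k+1}, c_{2k+2}).
-- In these coordinates x, y and z act by explicit affine maps: x replaces each pair (s, t)
-- by (s + t, t) and twists the exponent of a by the parity of the t's, while y and z act on v
-- through the linear map τ (adding the last pair on odd powers of a).  On the elements
-- a^{±1} c^v the achievable translations v ↦ v + w form a subspace that contains the last
-- pair and is stable under both linear maps; these generate everything, so all a^{±1} c^v lie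
-- in one orbit.  Every other coset a^i b^j ⟨c⟩ is joined to it by a short explicit word,
-- except ⟨c⟩ itself: there τ and x move the leading nonzero pair of v to the front until the
-- parity of the t's is odd, and then x leaves ⟨c⟩.

module Submission where

open import Defs
  hiding (_·_; inv; pow; prodOver; cprod; a; b; a²; c; xc; τc; τ; x; y; z; h)
open import Data.Nat using (ℕ; _≤_; _%_)
open import Data.Product using (_×_)
open import Relation.Binary.PropositionalEquality using (_≡_; _≢_)

import Defs as D
open import Algebra.Bundles using (CommutativeRing)
open import Data.Bool using (Bool; true; false; if_then_else_; _xor_; _∧_; not)
open import Data.Bool.Properties
  using (xor-assoc; xor-comm; xor-identityˡ; xor-identityʳ; xor-same; ∧-identityʳ; ∧-zeroʳ; xor-∧-commutativeRing)
open import Data.Empty using (⊥-elim)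
open import Data.Fin as Fin using (Fin; toℕ; fromℕ; fromℕ<; inject₁)
open import Data.Fin.Induction using (<-weakInduction; >-weakInduction)
open import Data.Fin.Properties using (toℕ-fromℕ<; toℕ<n) renaming (_≟_ to _≟ᶠ_)
open import Data.Integer as ℤ using (ℤ; +_; -[1+_])
open import Data.Nat as ℕ using (zero; suc; _∸_; ⌊_/2⌋; _≡ᵇ_; _<?_; s≤s)
open import Data.Nat.Properties using (+-suc; +-comm; 0≢1+n)
open import Data.Product using (∃; _,_; proj₁; proj₂)
open import Data.Sum using (_⊎_; inj₁; inj₂)
open import Data.Vec using (Vec; []; _∷_; lookup; replicate; zipWith; tabulate)
open import Data.Vec.Properties using (lookup∘tabulate; tabulate∘lookup; tabulate-cong)
open import Data.Vec.Relation.Binary.Pointwise.Inductive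
  using (Pointwise-≡⇒≡; zipWith-assoc; zipWith-comm; zipWith-identityˡ; zipWith-identityʳ)
open import Relation.Binary.Construct.Closure.ReflexiveTransitive using (ε; _◅_; _◅◅_)
open import Relation.Binary.PropositionalEquality using (refl; sym; trans; cong; cong₂; subst; module ≡-Reasoning)
open import Relation.Nullary.Decidable using (does; isYes; yes; no; isYes≗does; dec-false)
open import Algebra.Properties.CommutativeSemigroup
  (CommutativeRing.+-commutativeSemigroup xor-∧-commutativeRing) using (interchange)

double : ℕ → ℕ
double zero    = zero
double (suc n) = suc (suc (double n))

data Parity : ℕ → Set where
  even : ∀ g → Parity (double g)
  odd  : ∀ g → Parity (suc (double g))

parity : ∀ n → Parity n
parity zero = even zero
parity (suc n) with parity n
... | even g = odd g
... | odd  g = even (suc g)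

2*-double : ∀ g → 2 ℕ.* g ≡ double g
2*-double zero    = refl
2*-double (suc g) = cong suc (trans (+-suc g (g ℕ.+ 0)) (cong suc (2*-double g)))

2*-+1 : ∀ g → 2 ℕ.* g ℕ.+ 1 ≡ suc (double g)
2*-+1 g = trans (+-comm (2 ℕ.* g) 1) (cong suc (2*-double g))

2*-+2 : ∀ g → 2 ℕ.* g ℕ.+ 2 ≡ suc (suc (double g))
2*-+2 g = trans (+-comm (2 ℕ.* g) 2) (cong (λ n → suc (suc n)) (2*-double g))

⌊double/2⌋ : ∀ g → ⌊ double g /2⌋ ≡ g
⌊double/2⌋ zero    = refl
⌊double/2⌋ (suc g) = cong suc (⌊double/2⌋ g)

⌊suc-double/2⌋ : ∀ g → ⌊ suc (double g) /2⌋ ≡ g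
⌊suc-double/2⌋ zero    = refl
⌊suc-double/2⌋ (suc g) = cong suc (⌊suc-double/2⌋ g)

isOdd : ℕ → Bool
isOdd n = does (n % 2 ℕ.≟ 1)

isOdd-double : ∀ g → isOdd (double g) ≡ false
isOdd-double zero    = refl
isOdd-double (suc g) = isOdd-double g

isOdd-suc-double : ∀ g → isOdd (suc (double g)) ≡ true
isOdd-suc-double zero    = refl
isOdd-suc-double (suc g) = isOdd-suc-double g

xor-cancelʳ : ∀ s t → (s xor t) xor t ≡ s
xor-cancelʳ s t = trans (xor-assoc s t t) (trans (cong (s xor_) (xor-same t)) (xor-identityʳ s))

xor-shift : ∀ s t n → (s xor n) xor (t xor n) ≡ s xor t
xor-shift s t n = trans (interchange s n t n) (trans (cong ((s xor t) xor_) (xor-same n)) (xor-identityʳ _))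

infixl 6 _⊕_

_⊕_ : ∀ {n} → Vec Bool n → Vec Bool n → Vec Bool n
_⊕_ = zipWith _xor_

zeros : ∀ {n} → Vec Bool n
zeros = replicate _ false

⊕-assoc : ∀ {n} (u v w : Vec Bool n) → (u ⊕ v) ⊕ w ≡ u ⊕ (v ⊕ w)
⊕-assoc u v w = Pointwise-≡⇒≡ (zipWith-assoc xor-assoc u v w)

⊕-comm : ∀ {n} (u v : Vec Bool n) → u ⊕ v ≡ v ⊕ u
⊕-comm u v = Pointwise-≡⇒≡ (zipWith-comm xor-comm u v)

⊕-identityˡ : ∀ {n} (v : Vec Bool n) → zeros ⊕ v ≡ v
⊕-identityˡ v = Pointwise-≡⇒≡ (zipWith-identityˡ xor-identityˡ v)

⊕-identityʳ : ∀ {n} (v : Vec Bool n) → v ⊕ zeros ≡ v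
⊕-identityʳ v = Pointwise-≡⇒≡ (zipWith-identityʳ xor-identityʳ v)

⊕-self : ∀ {n} (v : Vec Bool n) → v ⊕ v ≡ zeros
⊕-self []      = refl
⊕-self (s ∷ v) = cong₂ _∷_ (xor-same s) (⊕-self v)

⊕-cancelˡ : ∀ {n} (u v : Vec Bool n) → u ⊕ (u ⊕ v) ≡ v
⊕-cancelˡ u v = trans (sym (⊕-assoc u u v)) (trans (cong (_⊕ v) (⊕-self u)) (⊕-identityˡ v))

⊕-cancelʳ : ∀ {n} (u v : Vec Bool n) → (u ⊕ v) ⊕ v ≡ u
⊕-cancelʳ u v = trans (⊕-assoc u v v) (trans (cong (u ⊕_) (⊕-self v)) (⊕-identityʳ u))

-- lookup at a natural-number index, false past the end
lookupℕ : ∀ {n} → Vec Bool n → ℕ → Bool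
lookupℕ []      _       = false
lookupℕ (s ∷ v) zero    = s
lookupℕ (s ∷ v) (suc j) = lookupℕ v j

lookupℕ-toℕ : ∀ {n} (v : Vec Bool n) j → lookupℕ v (toℕ j) ≡ lookup v j
lookupℕ-toℕ (s ∷ v) Fin.zero    = refl
lookupℕ-toℕ (s ∷ v) (Fin.suc j) = lookupℕ-toℕ v j

lookupℕ-⊕ : ∀ {n} (u v : Vec Bool n) J → lookupℕ (u ⊕ v) J ≡ lookupℕ u J xor lookupℕ v J
lookupℕ-⊕ []      []      J       = refl
lookupℕ-⊕ (s ∷ u) (t ∷ v) zero    = refl
lookupℕ-⊕ (s ∷ u) (t ∷ v) (suc J) = lookupℕ-⊕ u v J

lookupℕ-zeros : ∀ {n} J → lookupℕ (zeros {n}) J ≡ false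
lookupℕ-zeros {zero}  J       = refl
lookupℕ-zeros {suc n} zero    = refl
lookupℕ-zeros {suc n} (suc J) = lookupℕ-zeros {n} J

lookupℕ-ext : ∀ {n} (u v : Vec Bool n) → (∀ j → lookupℕ u (toℕ j) ≡ lookupℕ v (toℕ j)) → u ≡ v
lookupℕ-ext u v eq = begin
  u                   ≡⟨ tabulate∘lookup u ⟨
  tabulate (lookup u) ≡⟨ tabulate-cong (λ j → trans (sym (lookupℕ-toℕ u j)) (trans (eq j) (lookupℕ-toℕ v j))) ⟩
  tabulate (lookup v) ≡⟨ tabulate∘lookup v ⟩
  v                   ∎
  where open ≡-Reasoning

xorSum : ∀ {n} → (Fin n → Bool) → Bool
xorSum {zero}  f = false
xorSum {suc n} f = f Fin.zero xor xorSum (λ k → f (Fin.suc k))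

xorSum-false : ∀ n → xorSum {n} (λ _ → false) ≡ false
xorSum-false zero    = refl
xorSum-false (suc n) = xorSum-false n

xorSum-cong : ∀ {n} {f g : Fin n → Bool} → (∀ k → f k ≡ g k) → xorSum f ≡ xorSum g
xorSum-cong {zero}  eq = refl
xorSum-cong {suc n} eq = cong₂ _xor_ (eq Fin.zero) (xorSum-cong (λ k → eq (Fin.suc k)))

-- A vector in Vec Bool (double r) is read as r consecutive pairs; pair k holds the
-- exponents of c_{2k+1} and c_{2k+2}.

pairParity : ∀ {r} → Vec Bool (double r) → Bool
pairParity {zero}  []          = false
pairParity {suc r} (s ∷ t ∷ _) = s xor t

τ-vec : ∀ {r} → Vec Bool (double r) → Vec Bool (double r)
τ-vec {zero}  []          = []
τ-vec {suc r} (s ∷ t ∷ w) = (t xor pairParity w) ∷ (s xor pairParity w) ∷ τ-vec w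

x-vec : ∀ {r} → Vec Bool (double r) → Vec Bool (double r)
x-vec {zero}  []          = []
x-vec {suc r} (s ∷ t ∷ w) = (s xor t) ∷ t ∷ x-vec w

a²-parity : ∀ {r} → Vec Bool (double r) → Bool
a²-parity {zero}  []          = false
a²-parity {suc r} (s ∷ t ∷ w) = t xor a²-parity w

pairParity-⊕ : ∀ {r} (u v : Vec Bool (double r)) → pairParity (u ⊕ v) ≡ pairParity u xor pairParity v
pairParity-⊕ {zero}  []          []          = refl
pairParity-⊕ {suc r} (s ∷ t ∷ u) (s′ ∷ t′ ∷ v) = interchange s s′ t t′

τ-vec-⊕ : ∀ {r} (u v : Vec Bool (double r)) → τ-vec (u ⊕ v) ≡ τ-vec u ⊕ τ-vec v
τ-vec-⊕ {zero}  []          []            = refl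
τ-vec-⊕ {suc r} (s ∷ t ∷ u) (s′ ∷ t′ ∷ v) rewrite pairParity-⊕ u v =
  cong₂ _∷_ (interchange t t′ (pairParity u) (pairParity v))
    (cong₂ _∷_ (interchange s s′ (pairParity u) (pairParity v)) (τ-vec-⊕ u v))

x-vec-⊕ : ∀ {r} (u v : Vec Bool (double r)) → x-vec (u ⊕ v) ≡ x-vec u ⊕ x-vec v
x-vec-⊕ {zero}  []          []            = refl
x-vec-⊕ {suc r} (s ∷ t ∷ u) (s′ ∷ t′ ∷ v) =
  cong₂ _∷_ (interchange s s′ t t′) (cong ((t xor t′) ∷_) (x-vec-⊕ u v))

pairParity-τ-vec : ∀ {r} (w : Vec Bool (double r)) → pairParity (τ-vec w) ≡ pairParity w
pairParity-τ-vec {zero}  []          = refl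
pairParity-τ-vec {suc r} (s ∷ t ∷ w) = trans (xor-shift t s (pairParity w)) (xor-comm t s)

τ-vec-involutive : ∀ {r} (w : Vec Bool (double r)) → τ-vec (τ-vec w) ≡ w
τ-vec-involutive {zero}  []          = refl
τ-vec-involutive {suc r} (s ∷ t ∷ w) rewrite pairParity-τ-vec w | τ-vec-involutive w =
  cong₂ _∷_ (xor-cancelʳ s (pairParity w)) (cong (_∷ w) (xor-cancelʳ t (pairParity w)))

x-vec-involutive : ∀ {r} (w : Vec Bool (double r)) → x-vec (x-vec w) ≡ w
x-vec-involutive {zero}  []          = refl
x-vec-involutive {suc r} (s ∷ t ∷ w) rewrite x-vec-involutive w = cong (λ s′ → s′ ∷ t ∷ w) (xor-cancelʳ s t)

a²-parity-x-vec : ∀ {r} (w : Vec Bool (double r)) → a²-parity (x-vec w) ≡ a²-parity w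
a²-parity-x-vec {zero}  []          = refl
a²-parity-x-vec {suc r} (s ∷ t ∷ w) = cong (t xor_) (a²-parity-x-vec w)

a²-parity-τ-vec : ∀ {r} (w : Vec Bool (double r)) → a²-parity (τ-vec w) ≡ a²-parity w xor pairParity w
a²-parity-τ-vec {zero}  []          = refl
a²-parity-τ-vec {suc r} (s ∷ t ∷ w) rewrite a²-parity-τ-vec w = begin
  (s xor pairParity w) xor (a²-parity w xor pairParity w) ≡⟨ xor-shift s (a²-parity w) (pairParity w) ⟩
  s xor a²-parity w                                       ≡⟨ xor-comm s (a²-parity w) ⟩
  a²-parity w xor s                                       ≡⟨ xor-shift (a²-parity w) s t ⟨
  (a²-parity w xor t) xor (s xor t)                       ≡⟨ cong (_xor (s xor t)) (xor-comm (a²-parity w) t) ⟩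
  (t xor a²-parity w) xor (s xor t)                       ∎
  where open ≡-Reasoning

a²-parity-zeros : ∀ r → a²-parity (zeros {double r}) ≡ false
a²-parity-zeros zero    = refl
a²-parity-zeros (suc r) = a²-parity-zeros r

x-vec-zeros : ∀ r → x-vec (zeros {double r}) ≡ zeros
x-vec-zeros zero    = refl
x-vec-zeros (suc r) = cong (λ w → false ∷ false ∷ w) (x-vec-zeros r)

pairParity-zeros : ∀ r → pairParity (zeros {double r}) ≡ false
pairParity-zeros zero    = refl
pairParity-zeros (suc r) = refl

τ-vec-zeros : ∀ r → τ-vec (zeros {double r}) ≡ zeros
τ-vec-zeros zero    = refl
τ-vec-zeros (suc r) rewrite pairParity-zeros r = cong (λ w → false ∷ false ∷ w) (τ-vec-zeros r)

unitPair : ∀ {r} → Fin r → Bool → Bool → Vec Bool (double r)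
unitPair {suc r} Fin.zero    s t = s ∷ t ∷ zeros
unitPair {suc r} (Fin.suc k) s t = false ∷ false ∷ unitPair k s t

unitPair-⊕ : ∀ {r} (k : Fin r) s t s′ t′ → unitPair k s t ⊕ unitPair k s′ t′ ≡ unitPair k (s xor s′) (t xor t′)
unitPair-⊕ {suc r} Fin.zero    s t s′ t′ = cong (λ w → (s xor s′) ∷ (t xor t′) ∷ w) (⊕-identityˡ zeros)
unitPair-⊕ {suc r} (Fin.suc k) s t s′ t′ = cong (λ w → false ∷ false ∷ w) (unitPair-⊕ k s t s′ t′)

unitPair-false : ∀ {r} (k : Fin r) → unitPair k false false ≡ zeros
unitPair-false {suc r} Fin.zero    = refl
unitPair-false {suc r} (Fin.suc k) = cong (λ w → false ∷ false ∷ w) (unitPair-false k)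

x-vec-unitPair : ∀ {r} (k : Fin r) s t → x-vec (unitPair k s t) ≡ unitPair k (s xor t) t
x-vec-unitPair {suc r} Fin.zero    s t = cong (λ w → (s xor t) ∷ t ∷ w) (x-vec-zeros r)
x-vec-unitPair {suc r} (Fin.suc k) s t = cong (λ w → false ∷ false ∷ w) (x-vec-unitPair k s t)

τ-vec-unitPair : ∀ {r} (k : Fin r) →
  τ-vec (unitPair (Fin.suc k) true false) ≡ unitPair (inject₁ k) true true ⊕ unitPair (Fin.suc k) false true
τ-vec-unitPair {suc r} Fin.zero
  rewrite pairParity-zeros r | τ-vec-zeros r | ⊕-identityˡ (false ∷ true ∷ zeros {double r}) = refl
τ-vec-unitPair {suc r} (Fin.suc k) = cong (λ w → false ∷ false ∷ w) (τ-vec-unitPair k)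

lastPair : ∀ r → Vec Bool (double (suc r))
lastPair r = unitPair (fromℕ r) true true

τ-vec-lastPair : ∀ r → τ-vec (lastPair r) ≡ lastPair r
τ-vec-lastPair zero          = refl
τ-vec-lastPair (suc zero)    = refl
τ-vec-lastPair (suc (suc r)) = cong (λ w → false ∷ false ∷ w) (τ-vec-lastPair (suc r))

-- c₁ c₃ c₅ ⋯, the c-part of h
hVec : ∀ {r} → Vec Bool (double r)
hVec {zero}  = []
hVec {suc r} = true ∷ false ∷ hVec

τ-vec-hVec : ∀ r → τ-vec (hVec {suc r}) ≡ hVec ⊕ lastPair r
τ-vec-hVec zero    = refl
τ-vec-hVec (suc r) = cong (λ w → true ∷ false ∷ w) (τ-vec-hVec r)

unitPair-induction : ∀ {r} (P : Vec Bool (double r) → Set) → P zeros →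
  (∀ {u v} → P u → P v → P (u ⊕ v)) → (∀ k s t → P (unitPair k s t)) → ∀ v → P v
unitPair-induction {zero}  P P0 P⊕ Punit [] = P0
unitPair-induction {suc r} P P0 P⊕ Punit (s ∷ t ∷ w) = subst P split
  (P⊕ (Punit Fin.zero s t)
      (unitPair-induction (λ u → P (false ∷ false ∷ u)) P0 P⊕ (λ k → Punit (Fin.suc k)) w))
  where
  split : unitPair Fin.zero s t ⊕ (false ∷ false ∷ w) ≡ s ∷ t ∷ w
  split = cong₂ _∷_ (xor-identityʳ s) (cong₂ _∷_ (xor-identityʳ t) (⊕-identityˡ w))

-- cBit n J: whether c_{J+1} occurs in c_n (with c_0 = 1).
cBit : ℕ → ℕ → Bool
cBit n J = suc J ≡ᵇ n

-- xBit n J and τBit n J: whether c_{J+1} occurs in the image of c_{n+1} under x and τ.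
xBit : ℕ → ℕ → Bool
xBit 0 0 = true
xBit 1 0 = true
xBit 1 1 = true
xBit (suc (suc n)) (suc (suc J)) = xBit n J
xBit _ _ = false

inFirstPair : ℕ → Bool
inFirstPair 0 = true
inFirstPair 1 = true
inFirstPair _ = false

τBit : ℕ → ℕ → Bool
τBit 0 1 = true
τBit 1 0 = true
τBit (suc (suc n)) 0 = inFirstPair n
τBit (suc (suc n)) 1 = inFirstPair n
τBit (suc (suc n)) (suc (suc J)) = τBit n J
τBit _ _ = false

xBit-even : ∀ g J → xBit (double g) J ≡ cBit (suc (double g)) J
xBit-even zero    zero          = refl
xBit-even zero    (suc zero)    = refl
xBit-even zero    (suc (suc J)) = refl
xBit-even (suc g) zero          = refl
xBit-even (suc g) (suc zero)    = refl
xBit-even (suc g) (suc (suc J)) = xBit-even g J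

xBit-odd : ∀ g J → xBit (suc (double g)) J ≡ cBit (suc (double g)) J xor cBit (suc (suc (double g))) J
xBit-odd zero    zero          = refl
xBit-odd zero    (suc zero)    = refl
xBit-odd zero    (suc (suc J)) = refl
xBit-odd (suc g) zero          = refl
xBit-odd (suc g) (suc zero)    = refl
xBit-odd (suc g) (suc (suc J)) = xBit-odd g J

τBit-even : ∀ g J → τBit (double g) J ≡ (cBit (double g ∸ 1) J xor cBit (double g) J) xor cBit (suc (suc (double g))) J
τBit-even zero          zero          = refl
τBit-even zero          (suc zero)    = refl
τBit-even zero          (suc (suc J)) = refl
τBit-even (suc zero)    zero          = refl
τBit-even (suc zero)    (suc zero)    = refl
τBit-even (suc zero)    (suc (suc J)) = τBit-even zero J
τBit-even (suc (suc g)) zero          = refl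
τBit-even (suc (suc g)) (suc zero)    = refl
τBit-even (suc (suc g)) (suc (suc J)) = τBit-even (suc g) J

τBit-odd : ∀ g J → τBit (suc (double g)) J ≡ (cBit (double g ∸ 1) J xor cBit (double g) J) xor cBit (suc (double g)) J
τBit-odd zero          zero          = refl
τBit-odd zero          (suc zero)    = refl
τBit-odd zero          (suc (suc J)) = refl
τBit-odd (suc zero)    zero          = refl
τBit-odd (suc zero)    (suc zero)    = refl
τBit-odd (suc zero)    (suc (suc J)) = τBit-odd zero J
τBit-odd (suc (suc g)) zero          = refl
τBit-odd (suc (suc g)) (suc zero)    = refl
τBit-odd (suc (suc g)) (suc (suc J)) = τBit-odd (suc g) J

xorSum-xBit : ∀ {r} (v : Vec Bool (double r)) J → xorSum (λ k → xBit (toℕ k) J ∧ lookup v k) ≡ lookupℕ (x-vec v) J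
xorSum-xBit {zero}  []          J             = refl
xorSum-xBit {suc r} (s ∷ t ∷ w) zero          rewrite xorSum-false (double r) = cong (s xor_) (xor-identityʳ t)
xorSum-xBit {suc r} (s ∷ t ∷ w) (suc zero)    rewrite xorSum-false (double r) = xor-identityʳ t
xorSum-xBit {suc r} (s ∷ t ∷ w) (suc (suc J)) = xorSum-xBit w J

xorSum-inFirstPair : ∀ {r} (w : Vec Bool (double r)) → xorSum (λ k → inFirstPair (toℕ k) ∧ lookup w k) ≡ pairParity w
xorSum-inFirstPair {zero}  []          = refl
xorSum-inFirstPair {suc r} (s ∷ t ∷ w) rewrite xorSum-false (double r) = cong (s xor_) (xor-identityʳ t)

xorSum-τBit : ∀ {r} (v : Vec Bool (double r)) J → xorSum (λ k → τBit (toℕ k) J ∧ lookup v k) ≡ lookupℕ (τ-vec v) J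
xorSum-τBit {zero}  []          J             = refl
xorSum-τBit {suc r} (s ∷ t ∷ w) zero          = cong (t xor_) (xorSum-inFirstPair w)
xorSum-τBit {suc r} (s ∷ t ∷ w) (suc zero)    = cong (s xor_) (xorSum-inFirstPair w)
xorSum-τBit {suc r} (s ∷ t ∷ w) (suc (suc J)) = xorSum-τBit w J

xorSum-odd : ∀ {r} (v : Vec Bool (double r)) → xorSum (λ k → isOdd (toℕ k) ∧ lookup v k) ≡ a²-parity v
xorSum-odd {zero}  []          = refl
xorSum-odd {suc r} (s ∷ t ∷ w) = cong (t xor_) (xorSum-odd w)

xorSum-hVec : ∀ r J → xorSum {r} (λ i → cBit (suc (double (toℕ i))) J) ≡ lookupℕ (hVec {r}) J
xorSum-hVec zero    J             = refl
xorSum-hVec (suc r) zero          = cong not (xorSum-false r)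
xorSum-hVec (suc r) (suc zero)    = xorSum-false r
xorSum-hVec (suc r) (suc (suc J)) = xorSum-hVec r J

module _ (r : ℕ) (v : Vec Bool (double (suc r))) where

  hVec-τ-vec : hVec ⊕ τ-vec (hVec ⊕ v) ≡ τ-vec v ⊕ lastPair r
  hVec-τ-vec = begin
    hVec ⊕ τ-vec (hVec ⊕ v)                 ≡⟨ cong (hVec ⊕_) (τ-vec-⊕ hVec v) ⟩
    hVec ⊕ (τ-vec hVec ⊕ τ-vec v)           ≡⟨ cong (λ w → hVec ⊕ (w ⊕ τ-vec v)) (τ-vec-hVec r) ⟩
    hVec ⊕ ((hVec ⊕ lastPair r) ⊕ τ-vec v)  ≡⟨ ⊕-assoc hVec (hVec ⊕ lastPair r) (τ-vec v) ⟨
    (hVec ⊕ (hVec ⊕ lastPair r)) ⊕ τ-vec v  ≡⟨ cong (_⊕ τ-vec v) (⊕-cancelˡ hVec (lastPair r)) ⟩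
    lastPair r ⊕ τ-vec v                    ≡⟨ ⊕-comm (lastPair r) (τ-vec v) ⟩
    τ-vec v ⊕ lastPair r                    ∎
    where open ≡-Reasoning

  τ-vec-⊕hVec : τ-vec (v ⊕ hVec) ⊕ hVec ≡ τ-vec v ⊕ lastPair r
  τ-vec-⊕hVec = begin
    τ-vec (v ⊕ hVec) ⊕ hVec                 ≡⟨ cong (_⊕ hVec) (τ-vec-⊕ v hVec) ⟩
    (τ-vec v ⊕ τ-vec hVec) ⊕ hVec           ≡⟨ cong (λ w → (τ-vec v ⊕ w) ⊕ hVec) (τ-vec-hVec r) ⟩
    (τ-vec v ⊕ (hVec ⊕ lastPair r)) ⊕ hVec  ≡⟨ cong (_⊕ hVec) (cong (τ-vec v ⊕_) (⊕-comm hVec (lastPair r))) ⟩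
    (τ-vec v ⊕ (lastPair r ⊕ hVec)) ⊕ hVec  ≡⟨ cong (_⊕ hVec) (⊕-assoc (τ-vec v) (lastPair r) hVec) ⟨
    ((τ-vec v ⊕ lastPair r) ⊕ hVec) ⊕ hVec  ≡⟨ ⊕-cancelʳ (τ-vec v ⊕ lastPair r) hVec ⟩
    τ-vec v ⊕ lastPair r                    ∎
    where open ≡-Reasoning

  τ-vec-⊕hVec-⊕lastPair : (τ-vec (v ⊕ hVec) ⊕ lastPair r) ⊕ hVec ≡ τ-vec v
  τ-vec-⊕hVec-⊕lastPair = begin
    (τ-vec (v ⊕ hVec) ⊕ lastPair r) ⊕ hVec  ≡⟨ ⊕-assoc (τ-vec (v ⊕ hVec)) (lastPair r) hVec ⟩
    τ-vec (v ⊕ hVec) ⊕ (lastPair r ⊕ hVec)  ≡⟨ cong (τ-vec (v ⊕ hVec) ⊕_) (⊕-comm (lastPair r) hVec) ⟩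
    τ-vec (v ⊕ hVec) ⊕ (hVec ⊕ lastPair r)  ≡⟨ ⊕-assoc (τ-vec (v ⊕ hVec)) hVec (lastPair r) ⟨
    (τ-vec (v ⊕ hVec) ⊕ hVec) ⊕ lastPair r  ≡⟨ cong (_⊕ lastPair r) τ-vec-⊕hVec ⟩
    (τ-vec v ⊕ lastPair r) ⊕ lastPair r     ≡⟨ ⊕-cancelʳ (τ-vec v) (lastPair r) ⟩
    τ-vec v                                 ∎
    where open ≡-Reasoning

τ-vec-⊕lastPair-involutive : ∀ r (v : Vec Bool (double (suc r))) → τ-vec (τ-vec v ⊕ lastPair r) ⊕ lastPair r ≡ v
τ-vec-⊕lastPair-involutive r v = begin
  τ-vec (τ-vec v ⊕ lastPair r) ⊕ lastPair r
    ≡⟨ cong (_⊕ lastPair r) (τ-vec-⊕ (τ-vec v) (lastPair r)) ⟩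
  (τ-vec (τ-vec v) ⊕ τ-vec (lastPair r)) ⊕ lastPair r
    ≡⟨ cong₂ (λ u w → (u ⊕ w) ⊕ lastPair r) (τ-vec-involutive v) (τ-vec-lastPair r) ⟩
  (v ⊕ lastPair r) ⊕ lastPair r
    ≡⟨ ⊕-cancelʳ v (lastPair r) ⟩
  v ∎
  where open ≡-Reasoning

LeadingPair : ∀ {r} → Fin r → Vec Bool (double r) → Set
LeadingPair {suc r} Fin.zero    (s ∷ t ∷ w) = s ≡ true ⊎ t ≡ true
LeadingPair {suc r} (Fin.suc k) (s ∷ t ∷ w) = s ≡ false × t ≡ false × LeadingPair k w

pairParityAt : ∀ {r} → Fin r → Vec Bool (double r) → Bool
pairParityAt {suc r} Fin.zero    (s ∷ t ∷ w) = s xor t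
pairParityAt {suc r} (Fin.suc k) (s ∷ t ∷ w) = pairParityAt k w

nonzero-LeadingPair : ∀ {r} (v : Vec Bool (double r)) → v ≢ zeros → ∃ λ k → LeadingPair k v
nonzero-LeadingPair {zero}  []                  v≢0 = ⊥-elim (v≢0 refl)
nonzero-LeadingPair {suc r} (true  ∷ t    ∷ w) v≢0 = Fin.zero , inj₁ refl
nonzero-LeadingPair {suc r} (false ∷ true ∷ w) v≢0 = Fin.zero , inj₂ refl
nonzero-LeadingPair {suc r} (false ∷ false ∷ w) v≢0 =
  let k , lead = nonzero-LeadingPair w (λ w≡0 → v≢0 (cong (λ u → false ∷ false ∷ u) w≡0))
  in Fin.suc k , refl , refl , lead

τ-vec-LeadingPair : ∀ {r} (k : Fin r) (v : Vec Bool (double (suc r))) →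
  LeadingPair (Fin.suc k) v → pairParityAt (Fin.suc k) v ≡ true → LeadingPair (inject₁ k) (τ-vec v)
τ-vec-LeadingPair {suc r} Fin.zero (false ∷ false ∷ s ∷ t ∷ w) (refl , refl , _) p≡1 = inj₁ p≡1
τ-vec-LeadingPair {suc r} (Fin.suc k) (false ∷ false ∷ false ∷ false ∷ w) (refl , refl , refl , refl , lead) p≡1 =
  refl , refl , τ-vec-LeadingPair k (false ∷ false ∷ w) (refl , refl , lead) p≡1

x-vec-LeadingPair : ∀ {r} (k : Fin r) (v : Vec Bool (double r)) → LeadingPair k v → pairParityAt k v ≡ false →
  LeadingPair k (x-vec v) × pairParityAt k (x-vec v) ≡ true
x-vec-LeadingPair {suc r} Fin.zero (true  ∷ true  ∷ w) lead          p≡0 = inj₂ refl , refl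
x-vec-LeadingPair {suc r} Fin.zero (false ∷ false ∷ w) (inj₁ ()) p≡0
x-vec-LeadingPair {suc r} Fin.zero (false ∷ false ∷ w) (inj₂ ()) p≡0
x-vec-LeadingPair {suc r} (Fin.suc k) (false ∷ false ∷ w) (refl , refl , lead) p≡0 =
  let lead′ , p≡1 = x-vec-LeadingPair k w lead p≡0 in (refl , refl , lead′) , p≡1

a²-parity-τ-vec-first : ∀ {r} (v : Vec Bool (double (suc r))) →
  a²-parity v ≡ false → pairParityAt Fin.zero v ≡ true → a²-parity (τ-vec v) ≡ true
a²-parity-τ-vec-first v@(_ ∷ _ ∷ _) T≡0 p≡1 = trans (a²-parity-τ-vec v) (cong₂ _xor_ T≡0 p≡1)

does-≟ᶠ : ∀ {n} (j k : Fin n) → does (j ≟ᶠ k) ≡ (toℕ j ≡ᵇ toℕ k)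
does-≟ᶠ Fin.zero    Fin.zero    = refl
does-≟ᶠ Fin.zero    (Fin.suc k) = refl
does-≟ᶠ (Fin.suc j) Fin.zero    = refl
does-≟ᶠ (Fin.suc j) (Fin.suc k) = does-≟ᶠ j k

even₄ odd₄ : Bool → Z4
even₄ false = Fin.zero
even₄ true  = Fin.suc (Fin.suc Fin.zero)
odd₄ false  = Fin.suc Fin.zero
odd₄ true   = Fin.suc (Fin.suc (Fin.suc Fin.zero))

even₄-+₄ : ∀ e e′ → even₄ e +₄ even₄ e′ ≡ even₄ (e xor e′)
even₄-+₄ false false = refl
even₄-+₄ false true  = refl
even₄-+₄ true  false = refl
even₄-+₄ true  true  = refl

-₄-even₄ : ∀ e → -₄ even₄ e ≡ even₄ e
-₄-even₄ false = refl
-₄-even₄ true  = refl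

-- Defs takes m implicitly, and m cannot be recovered from H m (whose last factor is
-- Vec Bool (m ∸ 3)), so the operations used below are instantiated at a fixed m here.
module Group (m : ℕ) where

  infixl 7 _·_

  _·_ : H m → H m → H m
  _·_ = D._·_ {m}

  inv : H m → H m
  inv = D.inv {m}

  pow : H m → ℕ → H m
  pow = D.pow {m}

  prodOver : ∀ {n} → (Fin n → H m) → H m
  prodOver = D.prodOver {m}

  cprod : (Fin (m ∸ 3) → H m) → Vec Bool (m ∸ 3) → H m
  cprod = D.cprod {m}

  a b a² h : H m
  a  = D.a {m}
  b  = D.b {m}
  a² = D.a² {m}
  h  = D.h {m}

  c : ℤ → H m
  c = D.c {m}

  xc τc : Fin (m ∸ 3) → H m
  xc = D.xc {m}
  τc = D.τc {m}

  x y z τ : H m → H m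
  x = D.x {m}
  y = D.y {m}
  z = D.z {m}
  τ = D.τ {m}

  a-exp : H m → Z4
  a-exp = proj₁

  b-exp : H m → Bool
  b-exp g = proj₁ (proj₂ g)

  c-vec : H m → Vec Bool (m ∸ 3)
  c-vec g = proj₂ (proj₂ g)

  c-bit : H m → ℕ → Bool
  c-bit g = lookupℕ (c-vec g)

  H-ext : ∀ {g g′ : H m} → a-exp g ≡ a-exp g′ → b-exp g ≡ b-exp g′ →
          (∀ j → c-bit g (toℕ j) ≡ c-bit g′ (toℕ j)) → g ≡ g′
  H-ext i≡ j≡ c≡ = cong₂ _,_ i≡ (cong₂ _,_ j≡ (lookupℕ-ext _ _ c≡))

  record EvenForm (g : H m) (e : Bool) : Set where
    constructor evenForm
    field
      b-exp-false : b-exp g ≡ false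
      a-exp-even  : a-exp g ≡ even₄ e

  ·-even : ∀ (g : H m) e w → g · (even₄ e , false , w) ≡ (a-exp g +₄ even₄ e , b-exp g , c-vec g ⊕ w)
  ·-even (i , false , v) e w = refl
  ·-even (i , true  , v) e w = cong (λ k → i +₄ k , true , v ⊕ w) (-₄-even₄ e)

  EvenForm-· : ∀ {g g′ : H m} {e e′} → EvenForm g e → EvenForm g′ e′ → EvenForm (g · g′) (e xor e′)
  EvenForm-· {_ , _ , _} {_ , _ , _} {e} {e′} (evenForm refl refl) (evenForm refl refl) = evenForm refl (even₄-+₄ e e′)

  EvenForm-prodOver : ∀ {n} {f : Fin n → H m} {e : Fin n → Bool} →
    (∀ k → EvenForm (f k) (e k)) → EvenForm (prodOver f) (xorSum e)
  EvenForm-prodOver {zero}  ef = evenForm refl refl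
  EvenForm-prodOver {suc n} ef = EvenForm-· (ef Fin.zero) (EvenForm-prodOver (λ k → ef (Fin.suc k)))

  EvenForm-cprod : ∀ {img : Fin (m ∸ 3) → H m} {e : Fin (m ∸ 3) → Bool} →
    (∀ k → EvenForm (img k) (e k)) → ∀ v → EvenForm (cprod img v) (xorSum (λ k → e k ∧ lookup v k))
  EvenForm-cprod {img} {e} ef v = EvenForm-prodOver masked
    where
    masked : ∀ k → EvenForm (if lookup v k then img k else one {m}) (e k ∧ lookup v k)
    masked k with lookup v k
    ... | true  rewrite ∧-identityʳ (e k) = ef k
    ... | false rewrite ∧-zeroʳ (e k) = evenForm refl refl

  c-bit-· : ∀ (g g′ : H m) J → c-bit (g · g′) J ≡ c-bit g J xor c-bit g′ J
  c-bit-· g g′ = lookupℕ-⊕ (c-vec g) (c-vec g′)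

  c-bit-prodOver : ∀ {n} (f : Fin n → H m) J → c-bit (prodOver f) J ≡ xorSum (λ k → c-bit (f k) J)
  c-bit-prodOver {zero}  f J = lookupℕ-zeros {m ∸ 3} J
  c-bit-prodOver {suc n} f J =
    trans (c-bit-· (f Fin.zero) (prodOver (λ k → f (Fin.suc k))) J)
          (cong (c-bit (f Fin.zero) J xor_) (c-bit-prodOver (λ k → f (Fin.suc k)) J))

  c-bit-cprod : ∀ (img : Fin (m ∸ 3) → H m) v J → c-bit (cprod img v) J ≡ xorSum (λ k → c-bit (img k) J ∧ lookup v k)
  c-bit-cprod img v J = trans (c-bit-prodOver (λ k → if lookup v k then img k else one {m}) J) (xorSum-cong masked)
    where
    masked : ∀ k → c-bit (if lookup v k then img k else one {m}) J ≡ c-bit (img k) J ∧ lookup v k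
    masked k with lookup v k
    ... | true  = sym (∧-identityʳ _)
    ... | false = trans (lookupℕ-zeros {m ∸ 3} J) (sym (∧-zeroʳ _))

  CFree : H m → Set
  CFree g = c-vec g ≡ zeros

  CFree-· : ∀ {g g′ : H m} → CFree g → CFree g′ → CFree (g · g′)
  CFree-· {_ , _ , _} {_ , _ , _} refl refl = ⊕-identityˡ zeros

  CFree-pow : ∀ {g : H m} → CFree g → ∀ n → CFree (pow g n)
  CFree-pow gc zero    = refl
  CFree-pow {g} gc (suc n) = CFree-· {g} {pow g n} gc (CFree-pow gc n)

  c-EvenForm : ∀ n → EvenForm (c n) false
  c-EvenForm -[1+ _ ]   = evenForm refl refl
  c-EvenForm (+ zero)   = evenForm refl refl
  c-EvenForm (+ suc k) with k <? (m ∸ 3)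
  ... | yes _ = evenForm refl refl
  ... | no  _ = evenForm refl refl

  c-bit-c : ∀ n (j : Fin (m ∸ 3)) → c-bit (c (+ n)) (toℕ j) ≡ cBit n (toℕ j)
  c-bit-c zero    j = lookupℕ-zeros {m ∸ 3} (toℕ j)
  c-bit-c (suc k) j with k <? (m ∸ 3)
  ... | yes k< = begin
    lookupℕ (tabulate λ i → isYes (i ≟ᶠ fromℕ< k<)) (toℕ j) ≡⟨ lookupℕ-toℕ (tabulate λ i → isYes (i ≟ᶠ fromℕ< k<)) j ⟩
    lookup (tabulate λ i → isYes (i ≟ᶠ fromℕ< k<)) j        ≡⟨ lookup∘tabulate _ j ⟩
    isYes (j ≟ᶠ fromℕ< k<)                                  ≡⟨ isYes≗does _ ⟩
    does (j ≟ᶠ fromℕ< k<)                                   ≡⟨ does-≟ᶠ j _ ⟩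
    (toℕ j ≡ᵇ toℕ (fromℕ< k<))                               ≡⟨ cong (toℕ j ≡ᵇ_) (toℕ-fromℕ< k<) ⟩
    (toℕ j ≡ᵇ k)                                            ∎
    where open ≡-Reasoning
  ... | no k≮ = trans (lookupℕ-zeros {m ∸ 3} (toℕ j))
                  (sym (dec-false (toℕ j ℕ.≟ k) λ j≡k → k≮ (subst (ℕ._< m ∸ 3) j≡k (toℕ<n j))))

  c-pred-2* : ∀ g → c (+ (2 ℕ.* g) ℤ.- + 1) ≡ c (+ (double g ∸ 1))
  c-pred-2* g = trans (c-pred (2 ℕ.* g)) (cong (λ n → c (+ (n ∸ 1))) (2*-double g))
    where
    c-pred : ∀ n → c (+ n ℤ.- + 1) ≡ c (+ (n ∸ 1))
    c-pred zero    = refl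
    c-pred (suc n) = refl

  c-bit-CFree : ∀ {g : H m} → CFree g → ∀ J → c-bit g J ≡ false
  c-bit-CFree {g} gc J = trans (cong (λ w → lookupℕ w J) gc) (lookupℕ-zeros {m ∸ 3} J)

  c-bit-·₃ : ∀ (g₁ g₂ g₃ : H m) J → c-bit (g₁ · g₂ · g₃) J ≡ (c-bit g₁ J xor c-bit g₂ J) xor c-bit g₃ J
  c-bit-·₃ g₁ g₂ g₃ J = trans (c-bit-· (g₁ · g₂) g₃ J) (cong (_xor c-bit g₃ J) (c-bit-· g₁ g₂ J))

  cprod-normal : ∀ {img : Fin (m ∸ 3) → H m} {e : Fin (m ∸ 3) → Bool} (bit : Fin (m ∸ 3) → ℕ → Bool) v w →
    (∀ k → EvenForm (img k) (e k)) → (∀ k j → c-bit (img k) (toℕ j) ≡ bit k (toℕ j)) →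
    (∀ j → xorSum (λ k → bit k (toℕ j) ∧ lookup v k) ≡ lookupℕ w (toℕ j)) →
    cprod img v ≡ (even₄ (xorSum (λ k → e k ∧ lookup v k)) , false , w)
  cprod-normal {img} {e} bit v w img-even img-bit sum-bit =
    H-ext (EvenForm.a-exp-even prod-even) (EvenForm.b-exp-false prod-even) λ j →
      trans (c-bit-cprod img v (toℕ j)) (trans (xorSum-cong λ k → cong (_∧ lookup v k) (img-bit k j)) (sum-bit j))
    where
    prod-even : EvenForm (cprod img v) (xorSum (λ k → e k ∧ lookup v k))
    prod-even = EvenForm-cprod img-even v

  ·-even-CFree : ∀ {g : H m} → CFree g → ∀ e w → g · (even₄ e , false , w) ≡ (a-exp g +₄ even₄ e , b-exp g , w)
  ·-even-CFree {g} gc e w =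
    trans (·-even g e w) (cong (λ u → a-exp g +₄ even₄ e , b-exp g , u) (trans (cong (_⊕ w) gc) (⊕-identityˡ w)))

module Transitivity (r : ℕ) where

  -- Normal forms of x, y and z

  M : ℕ
  M = suc (suc (suc (double (suc r))))

  open Group M

  -- xc k and τc k unfold to xcℕ (toℕ k) and τcℕ (toℕ k), where the parity view applies.
  xcℕ τcℕ : ℕ → H M
  xcℕ n = if isOdd n then a² · c (+ (2 ℕ.* ⌊ n /2⌋ ℕ.+ 1)) · c (+ (2 ℕ.* ⌊ n /2⌋ ℕ.+ 2))
          else c (+ (2 ℕ.* ⌊ n /2⌋ ℕ.+ 1))
  τcℕ n = if isOdd n
          then c (+ (2 ℕ.* ⌊ n /2⌋) ℤ.- + 1) · c (+ (2 ℕ.* ⌊ n /2⌋)) · c (+ (2 ℕ.* ⌊ n /2⌋ ℕ.+ 1))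
          else c (+ (2 ℕ.* ⌊ n /2⌋) ℤ.- + 1) · c (+ (2 ℕ.* ⌊ n /2⌋)) · c (+ (2 ℕ.* ⌊ n /2⌋ ℕ.+ 2))

  xcℕ-double : ∀ g → xcℕ (double g) ≡ c (+ suc (double g))
  xcℕ-double g rewrite isOdd-double g | ⌊double/2⌋ g | 2*-+1 g = refl

  xcℕ-suc-double : ∀ g → xcℕ (suc (double g)) ≡ a² · c (+ suc (double g)) · c (+ suc (suc (double g)))
  xcℕ-suc-double g rewrite isOdd-suc-double g | ⌊suc-double/2⌋ g | 2*-+1 g | 2*-+2 g = refl

  τcℕ-double : ∀ g → τcℕ (double g) ≡ c (+ (double g ∸ 1)) · c (+ double g) · c (+ suc (suc (double g)))
  τcℕ-double g rewrite isOdd-double g | ⌊double/2⌋ g =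
    cong₂ _·_ (cong₂ _·_ (c-pred-2* g) (cong (λ n → c (+ n)) (2*-double g))) (cong (λ n → c (+ n)) (2*-+2 g))

  τcℕ-suc-double : ∀ g → τcℕ (suc (double g)) ≡ c (+ (double g ∸ 1)) · c (+ double g) · c (+ suc (double g))
  τcℕ-suc-double g rewrite isOdd-suc-double g | ⌊suc-double/2⌋ g =
    cong₂ _·_ (cong₂ _·_ (c-pred-2* g) (cong (λ n → c (+ n)) (2*-double g))) (cong (λ n → c (+ n)) (2*-+1 g))

  c-bit-a² : ∀ J → c-bit a² J ≡ false
  c-bit-a² = c-bit-CFree {a²} (CFree-pow {a} refl 2)

  a²-EvenForm : EvenForm a² true
  a²-EvenForm = evenForm refl refl

  xcℕ-EvenForm : ∀ n → EvenForm (xcℕ n) (isOdd n)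
  xcℕ-EvenForm n with parity n
  ... | even g rewrite xcℕ-double g | isOdd-double g = c-EvenForm (+ suc (double g))
  ... | odd  g rewrite xcℕ-suc-double g | isOdd-suc-double g =
    EvenForm-· (EvenForm-· a²-EvenForm (c-EvenForm (+ suc (double g)))) (c-EvenForm (+ suc (suc (double g))))

  xcℕ-bit : ∀ n j → c-bit (xcℕ n) (toℕ j) ≡ xBit n (toℕ j)
  xcℕ-bit n j with parity n
  ... | even g rewrite xcℕ-double g = trans (c-bit-c (suc (double g)) j) (sym (xBit-even g (toℕ j)))
  ... | odd  g rewrite xcℕ-suc-double g | c-bit-·₃ a² (c (+ suc (double g))) (c (+ suc (suc (double g)))) (toℕ j)
                     | c-bit-a² (toℕ j) | c-bit-c (suc (double g)) j | c-bit-c (suc (suc (double g))) j =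
    sym (xBit-odd g (toℕ j))

  τcℕ-EvenForm : ∀ n → EvenForm (τcℕ n) false
  τcℕ-EvenForm n with parity n
  ... | even g rewrite τcℕ-double g =
    EvenForm-· (EvenForm-· (c-EvenForm (+ (double g ∸ 1))) (c-EvenForm (+ double g))) (c-EvenForm (+ suc (suc (double g))))
  ... | odd  g rewrite τcℕ-suc-double g =
    EvenForm-· (EvenForm-· (c-EvenForm (+ (double g ∸ 1))) (c-EvenForm (+ double g))) (c-EvenForm (+ suc (double g)))

  τcℕ-bit : ∀ n j → c-bit (τcℕ n) (toℕ j) ≡ τBit n (toℕ j)
  τcℕ-bit n j with parity n
  ... | even g rewrite τcℕ-double g | c-bit-·₃ (c (+ (double g ∸ 1))) (c (+ double g)) (c (+ suc (suc (double g)))) (toℕ j)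
                     | c-bit-c (double g ∸ 1) j | c-bit-c (double g) j | c-bit-c (suc (suc (double g))) j =
    sym (τBit-even g (toℕ j))
  ... | odd  g rewrite τcℕ-suc-double g | c-bit-·₃ (c (+ (double g ∸ 1))) (c (+ double g)) (c (+ suc (double g))) (toℕ j)
                     | c-bit-c (double g ∸ 1) j | c-bit-c (double g) j | c-bit-c (suc (double g)) j =
    sym (τBit-odd g (toℕ j))

  cprod-xc : ∀ v → cprod xc v ≡ (even₄ (a²-parity v) , false , x-vec v)
  cprod-xc v = trans
    (cprod-normal (λ k → xBit (toℕ k)) v (x-vec v) (λ k → xcℕ-EvenForm (toℕ k)) (λ k → xcℕ-bit (toℕ k))
      (λ j → xorSum-xBit v (toℕ j)))
    (cong (λ e → even₄ e , false , x-vec v) (xorSum-odd v))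

  cprod-τc : ∀ v → cprod τc v ≡ (even₄ false , false , τ-vec v)
  cprod-τc v = trans
    (cprod-normal (λ k → τBit (toℕ k)) v (τ-vec v) (λ k → τcℕ-EvenForm (toℕ k)) (λ k → τcℕ-bit (toℕ k))
      (λ j → xorSum-τBit v (toℕ j)))
    (cong (λ e → even₄ e , false , τ-vec v) (xorSum-false (double (suc r))))

  ĥ ĥ⁻¹ : H M
  ĥ   = odd₄ false , false , hVec {suc r}
  ĥ⁻¹ = odd₄ true  , false , hVec {suc r}

  h-normal : h ≡ ĥ
  h-normal = begin
    a · prodOver {suc ⌊ double r /2⌋} (λ i → c (+ (2 ℕ.* toℕ i ℕ.+ 1)))
      ≡⟨ cong (λ n → a · prodOver {suc n} (λ i → c (+ (2 ℕ.* toℕ i ℕ.+ 1)))) (⌊double/2⌋ r) ⟩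
    a · P
      ≡⟨ H-ext (cong (odd₄ false +₄_) (EvenForm.a-exp-even P-even)) (EvenForm.b-exp-false P-even) P-bit ⟩
    ĥ ∎
    where
    open ≡-Reasoning
    factor : Fin (suc r) → H M
    factor i = c (+ (2 ℕ.* toℕ i ℕ.+ 1))
    P : H M
    P = prodOver factor
    P-even : EvenForm P false
    P-even = subst (EvenForm P) (xorSum-false (suc r)) (EvenForm-prodOver {suc r} (λ i → c-EvenForm (+ (2 ℕ.* toℕ i ℕ.+ 1))))
    P-bit : ∀ j → c-bit (a · P) (toℕ j) ≡ lookupℕ (hVec {suc r}) (toℕ j)
    P-bit j = begin
      c-bit (a · P) (toℕ j)
        ≡⟨ c-bit-· a P (toℕ j) ⟩
      c-bit a (toℕ j) xor c-bit P (toℕ j)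
        ≡⟨ cong (_xor c-bit P (toℕ j)) (c-bit-CFree {a} refl (toℕ j)) ⟩
      c-bit P (toℕ j)
        ≡⟨ c-bit-prodOver factor (toℕ j) ⟩
      xorSum (λ i → c-bit (factor i) (toℕ j))
        ≡⟨ xorSum-cong {suc r} (λ i → trans (c-bit-c (2 ℕ.* toℕ i ℕ.+ 1) j) (cong (λ n → cBit n (toℕ j)) (2*-+1 (toℕ i)))) ⟩
      xorSum {suc r} (λ i → cBit (suc (double (toℕ i))) (toℕ j))
        ≡⟨ xorSum-hVec (suc r) (toℕ j) ⟩
      lookupℕ (hVec {suc r}) (toℕ j) ∎

  oneIf : Bool → Z4
  oneIf false = Fin.zero
  oneIf true  = Fin.suc Fin.zero

  -- the a,b-parts of x (a^i b^j c^v) and τ (a^{2e} b^j c^v)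
  xD8 : Z4 → Bool → H M
  xD8 i j = pow (inv a) (toℕ i) · pow (a · b) (if j then 1 else 0)

  τD8 : Bool → Bool → H M
  τD8 e j = pow b ⌊ toℕ (even₄ e) /2⌋ · pow a² (if j then 1 else 0)

  xD8-CFree : ∀ i j → CFree (xD8 i j)
  xD8-CFree i j = CFree-· {pow (inv a) (toℕ i)} {pow (a · b) (if j then 1 else 0)}
    (CFree-pow {inv a} refl (toℕ i)) (CFree-pow {a · b} (CFree-· {a} {b} refl refl) (if j then 1 else 0))

  τD8-CFree : ∀ e j → CFree (τD8 e j)
  τD8-CFree e j = CFree-· {pow b ⌊ toℕ (even₄ e) /2⌋} {pow a² (if j then 1 else 0)}
    (CFree-pow {b} refl ⌊ toℕ (even₄ e) /2⌋) (CFree-pow {a²} (CFree-pow {a} refl 2) (if j then 1 else 0))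

  xD8-a-exp : ∀ i j → a-exp (xD8 i j) ≡ (-₄ i) +₄ oneIf j
  xD8-a-exp Fin.zero                                  false = refl
  xD8-a-exp Fin.zero                                  true  = refl
  xD8-a-exp (Fin.suc Fin.zero)                        false = refl
  xD8-a-exp (Fin.suc Fin.zero)                        true  = refl
  xD8-a-exp (Fin.suc (Fin.suc Fin.zero))              false = refl
  xD8-a-exp (Fin.suc (Fin.suc Fin.zero))              true  = refl
  xD8-a-exp (Fin.suc (Fin.suc (Fin.suc Fin.zero)))    false = refl
  xD8-a-exp (Fin.suc (Fin.suc (Fin.suc Fin.zero)))    true  = refl

  xD8-b-exp : ∀ i j → b-exp (xD8 i j) ≡ j
  xD8-b-exp Fin.zero                                  false = refl
  xD8-b-exp Fin.zero                                  true  = refl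
  xD8-b-exp (Fin.suc Fin.zero)                        false = refl
  xD8-b-exp (Fin.suc Fin.zero)                        true  = refl
  xD8-b-exp (Fin.suc (Fin.suc Fin.zero))              false = refl
  xD8-b-exp (Fin.suc (Fin.suc Fin.zero))              true  = refl
  xD8-b-exp (Fin.suc (Fin.suc (Fin.suc Fin.zero)))    false = refl
  xD8-b-exp (Fin.suc (Fin.suc (Fin.suc Fin.zero)))    true  = refl

  τD8-a-exp : ∀ e j → a-exp (τD8 e j) +₄ even₄ false ≡ even₄ j
  τD8-a-exp false false = refl
  τD8-a-exp false true  = refl
  τD8-a-exp true  false = refl
  τD8-a-exp true  true  = refl

  τD8-b-exp : ∀ e j → b-exp (τD8 e j) ≡ e
  τD8-b-exp false false = refl
  τD8-b-exp false true  = refl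
  τD8-b-exp true  false = refl
  τD8-b-exp true  true  = refl

  x-normal : ∀ i j v → x (i , j , v) ≡ (((-₄ i) +₄ oneIf j) +₄ even₄ (a²-parity v) , j , x-vec v)
  x-normal i j v = begin
    xD8 i j · cprod xc v                                           ≡⟨ cong (xD8 i j ·_) (cprod-xc v) ⟩
    xD8 i j · (even₄ T , false , x-vec v)                          ≡⟨ ·-even-CFree {xD8 i j} (xD8-CFree i j) T (x-vec v) ⟩
    (a-exp (xD8 i j) +₄ even₄ T , b-exp (xD8 i j) , x-vec v)       ≡⟨ cong₂ _,_ (cong (_+₄ even₄ T) (xD8-a-exp i j))
                                                                         (cong (_, x-vec v) (xD8-b-exp i j)) ⟩
    (((-₄ i) +₄ oneIf j) +₄ even₄ T , j , x-vec v)                   ∎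
    where
    open ≡-Reasoning
    T : Bool
    T = a²-parity v

  τ-normal : ∀ e j v → τ (even₄ e , j , v) ≡ (even₄ j , e , τ-vec v)
  τ-normal e j v = begin
    τD8 e j · cprod τc v
      ≡⟨ cong (τD8 e j ·_) (cprod-τc v) ⟩
    τD8 e j · (even₄ false , false , τ-vec v)
      ≡⟨ ·-even-CFree {τD8 e j} (τD8-CFree e j) false (τ-vec v) ⟩
    (a-exp (τD8 e j) +₄ even₄ false , b-exp (τD8 e j) , τ-vec v)
      ≡⟨ cong₂ _,_ (τD8-a-exp e j) (cong (_, τ-vec v) (τD8-b-exp e j)) ⟩
    (even₄ j , e , τ-vec v) ∎
    where open ≡-Reasoning

  y-even : ∀ e j v → y (even₄ e , j , v) ≡ (even₄ j , e , τ-vec v)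
  y-even false = τ-normal false
  y-even true  = τ-normal true

  y-odd-unfold : ∀ e j v → y (odd₄ e , j , v) ≡ h · τ (inv h · (odd₄ e , j , v))
  y-odd-unfold false j v = refl
  y-odd-unfold true  j v = refl

  ĥ⁻¹·odd : ∀ e j v → ĥ⁻¹ · (odd₄ e , j , v) ≡ (even₄ e , j , hVec ⊕ v)
  ĥ⁻¹·odd false j v = refl
  ĥ⁻¹·odd true  j v = refl

  ĥ·even : ∀ j e w → ĥ · (even₄ j , e , w) ≡ (odd₄ j , e , hVec ⊕ w)
  ĥ·even false e w = refl
  ĥ·even true  e w = refl

  even·ĥ : ∀ e j v → (even₄ e , j , v) · ĥ ≡ (odd₄ (e xor j) , j , v ⊕ hVec)
  even·ĥ false false v = refl
  even·ĥ false true  v = refl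
  even·ĥ true  false v = refl
  even·ĥ true  true  v = refl

  odd·ĥ : ∀ e j v → (odd₄ e , j , v) · ĥ ≡ (even₄ (not (e xor j)) , j , v ⊕ hVec)
  odd·ĥ false false v = refl
  odd·ĥ false true  v = refl
  odd·ĥ true  false v = refl
  odd·ĥ true  true  v = refl

  odd·ĥ⁻¹ : ∀ e j w → (odd₄ j , e xor j , w) · ĥ⁻¹ ≡ (even₄ e , e xor j , w ⊕ hVec)
  odd·ĥ⁻¹ false false w = refl
  odd·ĥ⁻¹ false true  w = refl
  odd·ĥ⁻¹ true  false w = refl
  odd·ĥ⁻¹ true  true  w = refl

  even·ĥ⁻¹ : ∀ e j w → (even₄ j , not (e xor j) , w) · ĥ⁻¹ ≡ (odd₄ e , not (e xor j) , w ⊕ hVec)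
  even·ĥ⁻¹ false false w = refl
  even·ĥ⁻¹ false true  w = refl
  even·ĥ⁻¹ true  false w = refl
  even·ĥ⁻¹ true  true  w = refl

  y-odd : ∀ e j v → y (odd₄ e , j , v) ≡ (odd₄ j , e , τ-vec v ⊕ lastPair r)
  y-odd e j v = begin
    y (odd₄ e , j , v)                         ≡⟨ y-odd-unfold e j v ⟩
    h · τ (inv h · (odd₄ e , j , v))           ≡⟨ cong (λ h′ → h′ · τ (inv h′ · (odd₄ e , j , v))) h-normal ⟩
    ĥ · τ (ĥ⁻¹ · (odd₄ e , j , v))             ≡⟨ cong (λ u → ĥ · τ u) (ĥ⁻¹·odd e j v) ⟩
    ĥ · τ (even₄ e , j , hVec ⊕ v)             ≡⟨ cong (ĥ ·_) (τ-normal e j (hVec ⊕ v)) ⟩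
    ĥ · (even₄ j , e , τ-vec (hVec ⊕ v))       ≡⟨ ĥ·even j e (τ-vec (hVec ⊕ v)) ⟩
    (odd₄ j , e , hVec ⊕ τ-vec (hVec ⊕ v))     ≡⟨ cong (λ w → odd₄ j , e , w) (hVec-τ-vec r v) ⟩
    (odd₄ j , e , τ-vec v ⊕ lastPair r)        ∎
    where open ≡-Reasoning

  z-even : ∀ e j v → z (even₄ e , j , v) ≡ (even₄ e , e xor j , τ-vec v)
  z-even e j v = begin
    y ((even₄ e , j , v) · h) · inv h
      ≡⟨ cong (λ h′ → y ((even₄ e , j , v) · h′) · inv h′) h-normal ⟩
    y ((even₄ e , j , v) · ĥ) · ĥ⁻¹
      ≡⟨ cong (λ u → y u · ĥ⁻¹) (even·ĥ e j v) ⟩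
    y (odd₄ (e xor j) , j , v ⊕ hVec) · ĥ⁻¹
      ≡⟨ cong (_· ĥ⁻¹) (y-odd (e xor j) j (v ⊕ hVec)) ⟩
    (odd₄ j , e xor j , τ-vec (v ⊕ hVec) ⊕ lastPair r) · ĥ⁻¹
      ≡⟨ odd·ĥ⁻¹ e j _ ⟩
    (even₄ e , e xor j , (τ-vec (v ⊕ hVec) ⊕ lastPair r) ⊕ hVec)
      ≡⟨ cong (λ w → even₄ e , e xor j , w) (τ-vec-⊕hVec-⊕lastPair r v) ⟩
    (even₄ e , e xor j , τ-vec v) ∎
    where open ≡-Reasoning

  z-odd : ∀ e j v → z (odd₄ e , j , v) ≡ (odd₄ e , not (e xor j) , τ-vec v ⊕ lastPair r)
  z-odd e j v = begin
    y ((odd₄ e , j , v) · h) · inv h                           ≡⟨ cong (λ h′ → y ((odd₄ e , j , v) · h′) · inv h′) h-normal ⟩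
    y ((odd₄ e , j , v) · ĥ) · ĥ⁻¹                             ≡⟨ cong (λ u → y u · ĥ⁻¹) (odd·ĥ e j v) ⟩
    y (even₄ (not (e xor j)) , j , v ⊕ hVec) · ĥ⁻¹             ≡⟨ cong (_· ĥ⁻¹) (y-even (not (e xor j)) j (v ⊕ hVec)) ⟩
    (even₄ j , not (e xor j) , τ-vec (v ⊕ hVec)) · ĥ⁻¹         ≡⟨ even·ĥ⁻¹ e j _ ⟩
    (odd₄ e , not (e xor j) , τ-vec (v ⊕ hVec) ⊕ hVec)         ≡⟨ cong (λ w → odd₄ e , not (e xor j) , w) (τ-vec-⊕hVec r v) ⟩
    (odd₄ e , not (e xor j) , τ-vec v ⊕ lastPair r)            ∎
    where open ≡-Reasoning

  -- Orbits

  infix 4 _~_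
  _~_ : H M → H M → Set
  _~_ = SameOrbit {M}

  ~-resp-≡ : ∀ {u v w} → u ~ v → v ≡ w → u ~ w
  ~-resp-≡ u~v refl = u~v

  ~-sym : ∀ {u v} → u ~ v → v ~ u
  ~-sym ε                       = ε
  ~-sym ((g , inj₁ eq) ◅ steps) = ~-sym steps ◅◅ ((g , inj₂ eq) ◅ ε)
  ~-sym ((g , inj₂ eq) ◅ steps) = ~-sym steps ◅◅ ((g , inj₁ eq) ◅ ε)

  step : ∀ g u → u ~ act {M} g u
  step g u = (g , inj₁ refl) ◅ ε

  x-step : ∀ i j v {T} → a²-parity v ≡ T → (i , j , v) ~ (((-₄ i) +₄ oneIf j) +₄ even₄ T , j , x-vec v)
  x-step i j v refl = ~-resp-≡ (step gx (i , j , v)) (x-normal i j v)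

  y-step-even : ∀ e j v → (even₄ e , j , v) ~ (even₄ j , e , τ-vec v)
  y-step-even e j v = ~-resp-≡ (step gy (even₄ e , j , v)) (y-even e j v)

  y-step-odd : ∀ e j v → (odd₄ e , j , v) ~ (odd₄ j , e , τ-vec v ⊕ lastPair r)
  y-step-odd e j v = ~-resp-≡ (step gy (odd₄ e , j , v)) (y-odd e j v)

  z-step-even : ∀ e j v → (even₄ e , j , v) ~ (even₄ e , e xor j , τ-vec v)
  z-step-even e j v = ~-resp-≡ (step gz (even₄ e , j , v)) (z-even e j v)

  z-step-odd : ∀ e j v → (odd₄ e , j , v) ~ (odd₄ e , not (e xor j) , τ-vec v ⊕ lastPair r)
  z-step-odd e j v = ~-resp-≡ (step gz (odd₄ e , j , v)) (z-odd e j v)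

  hub : Bool → Vec Bool (double (suc r)) → H M
  hub e v = odd₄ e , false , v

  hub-τ⊕lastPair : ∀ e v → hub e v ~ hub e (τ-vec v ⊕ lastPair r)
  hub-τ⊕lastPair false v = y-step-odd false false v
  hub-τ⊕lastPair true  v = z-step-odd true false v

  hub-x′ : ∀ e v {T} → a²-parity v ≡ T → hub e v ~ hub (not (e xor T)) (x-vec v)
  hub-x′ false v {false} T≡ = x-step (odd₄ false) false v T≡
  hub-x′ false v {true}  T≡ = x-step (odd₄ false) false v T≡
  hub-x′ true  v {false} T≡ = x-step (odd₄ true) false v T≡
  hub-x′ true  v {true}  T≡ = x-step (odd₄ true) false v T≡

  hub-x : ∀ e v → ∃ λ e′ → hub e v ~ hub e′ (x-vec v)
  hub-x e v = not (e xor a²-parity v) , hub-x′ e v refl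

  hub~ab : ∀ e v → hub e v ~ (odd₄ false , true , v)
  hub~ab false v = y-step-odd false false v ◅◅ ~-resp-≡ (z-step-odd false false (τ-vec v ⊕ lastPair r))
                     (cong (λ w → odd₄ false , true , w) (τ-vec-⊕lastPair-involutive r v))
  hub~ab true  v = z-step-odd true false v ◅◅ ~-resp-≡ (y-step-odd true false (τ-vec v ⊕ lastPair r))
                     (cong (λ w → odd₄ false , true , w) (τ-vec-⊕lastPair-involutive r v))

  ab~hub : ∀ v → (odd₄ false , true , v) ~ hub true v
  ab~hub v = y-step-odd false true v ◅◅ ~-resp-≡ (z-step-odd true false (τ-vec v ⊕ lastPair r))
               (cong (hub true) (τ-vec-⊕lastPair-involutive r v))

  ab~a²ᵉb : ∀ v {T} → a²-parity v ≡ T → (odd₄ false , true , v) ~ (even₄ T , true , x-vec v)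
  ab~a²ᵉb v {false} T≡ = x-step (odd₄ false) true v T≡
  ab~a²ᵉb v {true}  T≡ = x-step (odd₄ false) true v T≡

  a²ᵉb~ab : ∀ v {T} → a²-parity v ≡ T → (even₄ T , true , v) ~ (odd₄ false , true , x-vec v)
  a²ᵉb~ab v {false} T≡ = x-step (even₄ false) true v T≡
  a²ᵉb~ab v {true}  T≡ = x-step (even₄ true) true v T≡

  a²ᵉb-τ : ∀ e e′ v → (even₄ e , true , v) ~ (even₄ e′ , true , τ-vec v)
  a²ᵉb-τ true  true  v = y-step-even true true v
  a²ᵉb-τ false false v = z-step-even false true v
  a²ᵉb-τ true  false v = y-step-even true true v ◅◅ z-step-even true true (τ-vec v) ◅◅
    ~-resp-≡ (y-step-even true false (τ-vec (τ-vec v))) (cong (λ w → even₄ false , true , w) (τ-vec-involutive (τ-vec v)))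
  a²ᵉb-τ false true  v = y-step-even false true v ◅◅ z-step-even true false (τ-vec v) ◅◅
    ~-resp-≡ (y-step-even true true (τ-vec (τ-vec v))) (cong (λ w → even₄ true , true , w) (τ-vec-involutive (τ-vec v)))

  a²ᵉb~abτ : ∀ e v → (even₄ e , true , v) ~ (odd₄ false , true , x-vec (τ-vec v))
  a²ᵉb~abτ e v = a²ᵉb-τ e (a²-parity (τ-vec v)) v ◅◅ a²ᵉb~ab (τ-vec v) refl

  hub-xτx : ∀ e v → hub e v ~ hub true (x-vec (τ-vec (x-vec v)))
  hub-xτx e v = hub~ab e v ◅◅ ab~a²ᵉb v refl ◅◅ a²ᵉb~abτ (a²-parity v) (x-vec v) ◅◅ ab~hub _

  hub-τ : ∀ e v → ∃ λ e′ → hub e v ~ hub e′ (τ-vec v)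
  hub-τ e v =
    let e₁ , p₁ = hub-x e v
        e₂ , p₂ = hub-x true (x-vec (τ-vec (x-vec (x-vec v))))
    in e₂ , (p₁ ◅◅ hub-xτx e₁ (x-vec v) ◅◅
             ~-resp-≡ p₂ (cong (hub e₂) (trans (x-vec-involutive _) (cong τ-vec (x-vec-involutive v)))))

  HubShift : Vec Bool (double (suc r)) → Set
  HubShift w = ∀ e v → ∃ λ e′ → hub e v ~ hub e′ (v ⊕ w)

  HubShift-zeros : HubShift zeros
  HubShift-zeros e v = e , ~-resp-≡ ε (cong (hub e) (sym (⊕-identityʳ v)))

  HubShift-⊕ : ∀ {u w} → HubShift u → HubShift w → HubShift (u ⊕ w)
  HubShift-⊕ {u} {w} shift-u shift-w e v =
    let e₁ , p₁ = shift-u e v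
        e₂ , p₂ = shift-w e₁ (v ⊕ u)
    in e₂ , (p₁ ◅◅ ~-resp-≡ p₂ (cong (hub e₂) (⊕-assoc v u w)))

  HubShift-lastPair : HubShift (lastPair r)
  HubShift-lastPair e v =
    let e₁ , p₁ = hub-τ e v
    in e₁ , (p₁ ◅◅ ~-resp-≡ (hub-τ⊕lastPair e₁ (τ-vec v))
                              (cong (λ u → hub e₁ (u ⊕ lastPair r)) (τ-vec-involutive v)))

  HubShift-x-vec : ∀ {w} → HubShift w → HubShift (x-vec w)
  HubShift-x-vec {w} shift e v =
    let e₁ , p₁ = hub-x e v
        e₂ , p₂ = shift e₁ (x-vec v)
        e₃ , p₃ = hub-x e₂ (x-vec v ⊕ w)
    in e₃ , (p₁ ◅◅ p₂ ◅◅ ~-resp-≡ p₃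
                 (cong (hub e₃) (trans (x-vec-⊕ (x-vec v) w) (cong (_⊕ x-vec w) (x-vec-involutive v)))))

  HubShift-τ-vec : ∀ {w} → HubShift w → HubShift (τ-vec w)
  HubShift-τ-vec {w} shift e v =
    let e₁ , p₁ = hub-τ e v
        e₂ , p₂ = shift e₁ (τ-vec v)
        e₃ , p₃ = hub-τ e₂ (τ-vec v ⊕ w)
    in e₃ , (p₁ ◅◅ p₂ ◅◅ ~-resp-≡ p₃
                 (cong (hub e₃) (trans (τ-vec-⊕ (τ-vec v) w) (cong (_⊕ τ-vec w) (τ-vec-involutive v)))))

  HubShift-cong : ∀ {u w} → u ≡ w → HubShift u → HubShift w
  HubShift-cong refl shift = shift

  -- Downward induction from the last pair: x turns (1,1) into (0,1) in the same pair, and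
  -- τ of (1,0) in pair k+1 is (1,1) in pair k plus (0,1) in pair k+1.
  HubShift-unitPair-11 : ∀ k → HubShift (unitPair k true true)
  HubShift-unitPair-11 = >-weakInduction (λ k → HubShift (unitPair k true true)) HubShift-lastPair previous
    where
    previous : ∀ k → HubShift (unitPair (Fin.suc k) true true) → HubShift (unitPair (inject₁ k) true true)
    previous k shift-11 =
      let shift-01 = HubShift-cong (x-vec-unitPair (Fin.suc k) true true) (HubShift-x-vec shift-11)
          shift-10 = HubShift-cong (unitPair-⊕ (Fin.suc k) true true false true) (HubShift-⊕ shift-11 shift-01)
          shift-τ  = HubShift-cong (τ-vec-unitPair k) (HubShift-τ-vec shift-10)
      in HubShift-cong (⊕-cancelʳ (unitPair (inject₁ k) true true) (unitPair (Fin.suc k) false true))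
                       (HubShift-⊕ shift-τ shift-01)

  HubShift-unitPair : ∀ k s t → HubShift (unitPair k s t)
  HubShift-unitPair k true  true  = HubShift-unitPair-11 k
  HubShift-unitPair k false true  = HubShift-cong (x-vec-unitPair k true true) (HubShift-x-vec (HubShift-unitPair-11 k))
  HubShift-unitPair k true  false = HubShift-cong (unitPair-⊕ k true true false true)
                                      (HubShift-⊕ (HubShift-unitPair-11 k) (HubShift-unitPair k false true))
  HubShift-unitPair k false false = HubShift-cong (sym (unitPair-false k)) HubShift-zeros

  HubShift-all : ∀ w → HubShift w
  HubShift-all = unitPair-induction HubShift HubShift-zeros HubShift-⊕ HubShift-unitPair

  hub~a : ∀ e v → hub e v ~ a
  hub~a e v with HubShift-all v e v
  ... | false , p = ~-resp-≡ p (cong (hub false) (⊕-self v))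
  ... | true  , p = ~-resp-≡ p (cong (hub true) (⊕-self v)) ◅◅
                    ~-resp-≡ (x-step (odd₄ true) false zeros (a²-parity-zeros (suc r)))
                             (cong (hub false) (x-vec-zeros (suc r)))

  a²ᵉb~a : ∀ e v → (even₄ e , true , v) ~ a
  a²ᵉb~a e v = a²ᵉb~abτ e v ◅◅ ab~hub _ ◅◅ hub~a true _

  C-reaches-a : Vec Bool (double (suc r)) → Set
  C-reaches-a v = (Fin.zero , false , v) ~ a

  C-reaches-a-odd : ∀ v → a²-parity v ≡ true → C-reaches-a v
  C-reaches-a-odd v T≡1 = x-step Fin.zero false v T≡1 ◅◅ y-step-even true false (x-vec v) ◅◅ a²ᵉb~a false _

  C-reaches-a-τ : ∀ v → C-reaches-a (τ-vec v) → C-reaches-a v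
  C-reaches-a-τ v reach = y-step-even false false v ◅◅ reach

  C-reaches-a-x : ∀ v → a²-parity v ≡ false → C-reaches-a (x-vec v) → C-reaches-a v
  C-reaches-a-x v T≡0 reach = x-step Fin.zero false v T≡0 ◅◅ reach

  -- Apply τ (after x when the leading pair has even parity) to move the leading pair one step
  -- to the front; at the front this makes the a²-parity odd.
  C-reaches-a-leading : ∀ k v → LeadingPair k v → C-reaches-a v
  C-reaches-a-leading = <-weakInduction (λ k → ∀ v → LeadingPair k v → C-reaches-a v) first next
    where
    escape : ∀ k v → LeadingPair k v →
      (∀ u → LeadingPair k u → a²-parity u ≡ false → pairParityAt k u ≡ true → C-reaches-a (τ-vec u)) → C-reaches-a v
    escape k v lead τ-reaches with a²-parity v in T≡
    ... | true  = C-reaches-a-odd v T≡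
    ... | false with pairParityAt k v in p≡
    ...   | true  = C-reaches-a-τ v (τ-reaches v lead T≡ p≡)
    ...   | false =
      let lead′ , p′≡1 = x-vec-LeadingPair k v lead p≡
      in C-reaches-a-x v T≡ (C-reaches-a-τ (x-vec v) (τ-reaches (x-vec v) lead′ (trans (a²-parity-x-vec v) T≡) p′≡1))
    first : ∀ v → LeadingPair Fin.zero v → C-reaches-a v
    first v lead = escape Fin.zero v lead λ u _ T≡0 p≡1 → C-reaches-a-odd (τ-vec u) (a²-parity-τ-vec-first u T≡0 p≡1)
    next : ∀ k → (∀ v → LeadingPair (inject₁ k) v → C-reaches-a v) → ∀ v → LeadingPair (Fin.suc k) v → C-reaches-a v
    next k IH v lead = escape (Fin.suc k) v lead λ u lead′ _ p≡1 → IH (τ-vec u) (τ-vec-LeadingPair k u lead′ p≡1)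

  ≢one⇒~a : ∀ u → u ≢ one {M} → u ~ a
  ≢one⇒~a (Fin.zero , false , v) u≢1 =
    let k , lead = nonzero-LeadingPair v (λ v≡0 → u≢1 (cong (λ w → Fin.zero , false , w) v≡0))
    in C-reaches-a-leading k v lead
  ≢one⇒~a (Fin.zero , true , v) _ = a²ᵉb~a false v
  ≢one⇒~a (Fin.suc Fin.zero , false , v) _ = hub~a false v
  ≢one⇒~a (Fin.suc Fin.zero , true , v) _ = ab~hub v ◅◅ hub~a true v
  ≢one⇒~a (Fin.suc (Fin.suc Fin.zero) , false , v) _ = y-step-even true false v ◅◅ a²ᵉb~a false _
  ≢one⇒~a (Fin.suc (Fin.suc Fin.zero) , true , v) _ = a²ᵉb~a true v
  ≢one⇒~a (Fin.suc (Fin.suc (Fin.suc Fin.zero)) , false , v) _ = hub~a true v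
  ≢one⇒~a (Fin.suc (Fin.suc (Fin.suc Fin.zero)) , true , v) _ with a²-parity v in T≡
  ... | true  = x-step (odd₄ true) true v T≡ ◅◅ a²ᵉb~a false _
  ... | false = x-step (odd₄ true) true v T≡ ◅◅ a²ᵉb~a true _

  fixes-one : ∀ g → act {M} g (one {M}) ≡ one {M}
  fixes-one gx = trans (x-normal Fin.zero false zeros)
    (cong₂ (λ T w → ((-₄ Fin.zero) +₄ Fin.zero) +₄ even₄ T , false , w) (a²-parity-zeros (suc r)) (x-vec-zeros (suc r)))
  fixes-one gy = trans (y-even false false zeros) (cong (λ w → Fin.zero , false , w) (τ-vec-zeros (suc r)))
  fixes-one gz = trans (z-even false false zeros) (cong (λ w → Fin.zero , false , w) (τ-vec-zeros (suc r)))

double-%2 : ∀ g → double g % 2 ≡ 0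
double-%2 zero    = refl
double-%2 (suc g) = double-%2 g

odd≥5 : ∀ m → m % 2 ≡ 1 → 5 ≤ m → ∃ λ r → m ≡ 5 ℕ.+ double r
odd≥5 m m-odd 5≤m with parity m
... | even g = ⊥-elim (0≢1+n (trans (sym (double-%2 g)) m-odd))
odd≥5 _ _ (s≤s ())                 | odd zero
odd≥5 _ _ (s≤s (s≤s (s≤s ())))     | odd (suc zero)
... | odd (suc (suc r)) = r , refl

lemma3p6 : (m : ℕ) → m % 2 ≡ 1 → 5 ≤ m →
    ((g : Gen {m}) → act {m} g (one {m}) ≡ one {m}) ×
    ((u v : H m) → u ≢ one {m} → v ≢ one {m} → SameOrbit {m} u v)
lemma3p6 m m-odd 5≤m with odd≥5 m m-odd 5≤m
... | r , refl = fixes-one , λ u v u≢1 v≢1 → ≢one⇒~a u u≢1 ◅◅ ~-sym (≢one⇒~a v v≢1)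
  where open Transitivity r
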